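{- Let $\Omega$ be a set of orderings with no balanced pair. Then the relation $\prec$ is an irreflexive (strict) total order on the elements of $\Omega$.
   Context: A set of orderings $\Omega$ on a finite set $S$ is a nonempty set of total orderings of $S$; the members of $S$ are its elements. For distinct elements $x,y$, $\Pr[x<y]$ is the probability that $x$ occurs earlier than $y$ in a uniformly random ordering from $\Omega$. A balanced pair is a pair $x\ne y$ with $\frac13\le\Pr[x<y]\le\frac23$. The relation $\prec$ is defined by $x\prec y$ iff $\Pr[x<y]>\frac23$. -}

module Defs where

open import Data.Nat using (ℕ; NonZero)
open import Data.Fin using (Fin; _≟_)
open import Data.Bool using (Bool; true; false; if_then_else_)
open import Data.Product using (Σ; proj₁)
open import Data.List using (List; []; _∷_; length; map; filterᵇ; allFin)
open import Data.List.Relation.Binary.Permutation.Propositional using (_↭_)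
open import Data.List.Relation.Unary.Unique.Propositional using (Unique)
open import Data.Integer using (+_)
open import Data.Rational using (ℚ; _/_; _<_; _≤_)
open import Relation.Nullary using (does)
open import Relation.Binary.PropositionalEquality using (_≡_)
open import Relation.Binary.Structures using (IsStrictTotalOrder)

-- The finite ground set S is Fin n.
-- A total ordering of S: a list listing every element of S exactly once
-- (i.e. a permutation of allFin n), read from first to last.
TotalOrdering : ℕ → Set
TotalOrdering n = Σ (List (Fin n)) (λ l → l ↭ allFin n)

_∈ᵇ_ : ∀ {n} → Fin n → List (Fin n) → Bool
y ∈ᵇ []      = false
y ∈ᵇ (z ∷ l) = if does (z ≟ y) then true else (y ∈ᵇ l)

earlier : ∀ {n} → List (Fin n) → Fin n → Fin n → Bool
earlier []      x y = false
earlier (z ∷ l) x y =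
  if does (z ≟ x) then (y ∈ᵇ l)
  else (if does (z ≟ y) then false else earlier l x y)

record SetOfOrderings (n : ℕ) : Set where
  field
    orderings : List (TotalOrdering n)
    distinct  : Unique orderings
    nonempty  : NonZero (length orderings)
open SetOfOrderings public

-- Pr[x < y] for a uniformly random ordering from Ω.
Pr : ∀ {n} → SetOfOrderings n → Fin n → Fin n → ℚ
Pr Ω x y =
  (+ length (filterᵇ (λ o → earlier (proj₁ o) x y) (orderings Ω)))
    / length (orderings Ω)
  where instance _ = nonempty Ω

BalancedPair : ∀ {n} → SetOfOrderings n → Fin n → Fin n → Set
BalancedPair Ω x y =
  (x ≡ y → Data.Empty.⊥) Data.Product.×
  ((+ 1 / 3 ≤ Pr Ω x y) Data.Product.× (Pr Ω x y ≤ + 2 / 3))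
  where import Data.Empty; import Data.Product

_≺[_]_ : ∀ {n} → Fin n → SetOfOrderings n → Fin n → Set
x ≺[ Ω ] y = + 2 / 3 < Pr Ω x y

module Submission where

-- Write N = |Ω| and #(x<y) for the number of orderings in Ω
-- that put x before y, so Pr[x<y] = #(x<y)/N and x ≺ y ⟺ 2N < 3·#(x<y).
-- Inside a single total ordering "x before y" is irreflexive, for x ≠ y it
-- holds exactly when "y before x" fails, and three distinct elements are
-- never ordered cyclically.  Counting over Ω this gives
--   #(x<x) = 0,   #(x<y) + #(y<x) = N  (x ≠ y),
--   #(x<y) + #(y<z) + #(z<x) ≤ 2N      (x, y, z distinct).
-- Hence, for every Ω, ≺ is irreflexive, asymmetric and has no 3-cycle.  If
-- Ω has no balanced pair then for x ≠ y either #(x<y) > 2N/3 or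
-- #(x<y) < N/3, i.e. #(y<x) > 2N/3; so any two distinct elements are
-- ≺-comparable.  Transitivity follows: comparing x and z when x ≺ y ≺ z,
-- the outcomes x = z and z ≺ x are excluded by asymmetry and by the
-- absence of 3-cycles.

open import Defs
open import Data.Nat using (ℕ; suc; _+_; _*_; z≤n; s≤s; NonZero)
import Data.Nat as ℕ
open import Data.Nat.Properties
  using ( <-irrefl; ≤-refl; +-mono-≤; +-mono-<; +-monoˡ-<; +-cancelˡ-<
        ; *-monoˡ-≤; *-suc; *-identityˡ; *-distribʳ-+; m+n≮m; ≰⇒>; ≮⇒≥; n≮0; module ≤-Reasoning)
open import Data.Nat.Tactic.RingSolver using (solve-∀)
open import Data.Fin using (Fin; _≟_)
open import Data.Bool using (Bool; true; false; not; _∧_)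
open import Data.Bool.Properties using (∧-zeroʳ)
open import Data.Empty using (⊥; ⊥-elim)
open import Data.Product using (_,_; proj₁)
open import Data.List using (List; []; _∷_; length; filterᵇ)
open import Data.List.Membership.Propositional using (_∈_)
open import Data.List.Membership.Propositional.Properties using (∈-allFin)
open import Data.List.Relation.Unary.Any using (here; there)
open import Data.List.Relation.Unary.All using (All; []; _∷_)
open import Data.List.Relation.Unary.AllPairs using (_∷_)
open import Data.List.Relation.Unary.Unique.Propositional using (Unique)
open import Data.List.Relation.Unary.Unique.Propositional.Properties using (allFin⁺)
open import Data.List.Relation.Binary.Permutation.Propositional using (↭-sym; ↭⇒↭ₛ)
open import Data.List.Relation.Binary.Permutation.Propositional.Properties using (∈-resp-↭)
open import Data.List.Relation.Binary.Permutation.Setoid.Properties using (Unique-resp-↭)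
open import Data.Integer using (+_; +<+; +≤+)
open import Data.Integer.Properties using (pos-*; drop‿+<+)
import Data.Integer as ℤ
open import Data.Rational using (_/_)
import Data.Rational as ℚ
open import Data.Rational.Properties using (toℚᵘ-fromℚᵘ; toℚᵘ-mono-<; toℚᵘ-cancel-<; toℚᵘ-cancel-≤)
open import Data.Rational.Unnormalised using (mkℚᵘ; *<*; *≤*)
open import Data.Rational.Unnormalised.Properties using (≃-sym; <-respˡ-≃; <-respʳ-≃; ≤-respˡ-≃; ≤-respʳ-≃)
open import Relation.Nullary using (¬_; Dec; yes; no)
open import Relation.Binary.PropositionalEquality
  using (_≡_; _≢_; refl; sym; trans; cong; cong₂; subst; subst₂; isEquivalence; setoid; module ≡-Reasoning)
open import Relation.Binary.Structures using (IsStrictTotalOrder)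
open import Relation.Binary.Definitions using (Trichotomous; Tri; tri<; tri≈; tri>)

-- Comparing non-negative fractions a/b and c/d amounts to comparing the
-- cross products a·d and c·b.  (A fraction `+ a / suc b` normalises the
-- unnormalised rational a/(1+b), so we compare through ℚᵘ.)
module _ (a c : ℕ) where

  fraction-<⇒ : ∀ b d .{{_ : NonZero b}} .{{_ : NonZero d}} →
                + a / b ℚ.< + c / d → a * d ℕ.< c * b
  fraction-<⇒ (suc b) (suc d) p
    with <-respˡ-≃ (toℚᵘ-fromℚᵘ (mkℚᵘ (+ a) b))
           (<-respʳ-≃ (toℚᵘ-fromℚᵘ (mkℚᵘ (+ c) d)) (toℚᵘ-mono-< p))
  ... | *<* ad<cb = drop‿+<+ (subst₂ ℤ._<_ (sym (pos-* a (suc d))) (sym (pos-* c (suc b))) ad<cb)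

  fraction-<⇐ : ∀ b d .{{_ : NonZero b}} .{{_ : NonZero d}} →
                a * d ℕ.< c * b → + a / b ℚ.< + c / d
  fraction-<⇐ (suc b) (suc d) ad<cb = toℚᵘ-cancel-<
    (<-respˡ-≃ (≃-sym (toℚᵘ-fromℚᵘ (mkℚᵘ (+ a) b)))
      (<-respʳ-≃ (≃-sym (toℚᵘ-fromℚᵘ (mkℚᵘ (+ c) d)))
        (*<* (subst₂ ℤ._<_ (pos-* a (suc d)) (pos-* c (suc b)) (+<+ ad<cb)))))

  fraction-≤⇐ : ∀ b d .{{_ : NonZero b}} .{{_ : NonZero d}} →
                a * d ℕ.≤ c * b → + a / b ℚ.≤ + c / d
  fraction-≤⇐ (suc b) (suc d) ad≤cb = toℚᵘ-cancel-≤
    (≤-respˡ-≃ (≃-sym (toℚᵘ-fromℚᵘ (mkℚᵘ (+ a) b)))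
      (≤-respʳ-≃ (≃-sym (toℚᵘ-fromℚᵘ (mkℚᵘ (+ c) d)))
        (*≤* (subst₂ ℤ._≤_ (pos-* a (suc d)) (pos-* c (suc b)) (+≤+ ad≤cb)))))

BeyondTwoThirds : ℕ → ℕ → Set
BeyondTwoThirds N a = 2 * N ℕ.< a * 3

module _ (N : ℕ) where
  open ≤-Reasoning

  beyond-⅔-asym : ∀ a b → a + b ≡ N →
                  BeyondTwoThirds N a → BeyondTwoThirds N b → ⊥
  beyond-⅔-asym a b a+b≡N a>⅔ b>⅔ = m+n≮m (N * 3) N (begin-strict
    N * 3 + N       ≡⟨ four-thirds N ⟩
    2 * N + 2 * N   <⟨ +-mono-< a>⅔ b>⅔ ⟩
    a * 3 + b * 3   ≡⟨ *-distribʳ-+ 3 a b ⟨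
    (a + b) * 3     ≡⟨ cong (_* 3) a+b≡N ⟩
    N * 3           ∎)
    where
    four-thirds : ∀ n → n * 3 + n ≡ 2 * n + 2 * n
    four-thirds = solve-∀

  beyond-⅔-complement : ∀ a b → a + b ≡ N → a * 3 ℕ.< N → BeyondTwoThirds N b
  beyond-⅔-complement a b a+b≡N a<⅓ = +-cancelˡ-< (a * 3) (2 * N) (b * 3) (begin-strict
    a * 3 + 2 * N   <⟨ +-monoˡ-< (2 * N) a<⅓ ⟩
    N + 2 * N       ≡⟨ three-thirds N ⟩
    N * 3           ≡⟨ cong (_* 3) a+b≡N ⟨
    (a + b) * 3     ≡⟨ *-distribʳ-+ 3 a b ⟩
    a * 3 + b * 3   ∎)
    where
    three-thirds : ∀ n → n + 2 * n ≡ n * 3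
    three-thirds = solve-∀

  beyond-⅔-triple : ∀ a b c → a + b + c ℕ.≤ 2 * N →
                    BeyondTwoThirds N a → BeyondTwoThirds N b → BeyondTwoThirds N c → ⊥
  beyond-⅔-triple a b c sum≤2N a>⅔ b>⅔ c>⅔ = <-irrefl refl (begin-strict
    2 * N + 2 * N + 2 * N   <⟨ +-mono-< (+-mono-< a>⅔ b>⅔) c>⅔ ⟩
    a * 3 + b * 3 + c * 3   ≡⟨ distrib a b c ⟨
    (a + b + c) * 3         ≤⟨ *-monoˡ-≤ 3 sum≤2N ⟩
    2 * N * 3               ≡⟨ six-thirds N ⟩
    2 * N + 2 * N + 2 * N   ∎)
    where
    distrib : ∀ x y z → (x + y + z) * 3 ≡ x * 3 + y * 3 + z * 3
    distrib = solve-∀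
    six-thirds : ∀ n → 2 * n * 3 ≡ 2 * n + 2 * n + 2 * n
    six-thirds = solve-∀

count : {A : Set} → (A → Bool) → List A → ℕ
count f L = length (filterᵇ f L)

bit : Bool → ℕ
bit false = 0
bit true  = 1

bit≤1 : ∀ b → bit b ℕ.≤ 1
bit≤1 false = z≤n
bit≤1 true  = s≤s z≤n

bit-complement : ∀ b → bit (not b) + bit b ≡ 1
bit-complement false = refl
bit-complement true  = refl

bits-not-all-true : ∀ a b c → a ∧ b ∧ c ≡ false → bit a + bit b + bit c ℕ.≤ 2
bits-not-all-true false b     c     _ = +-mono-≤ (bit≤1 b) (bit≤1 c)
bits-not-all-true true  false c     _ = s≤s (bit≤1 c)
bits-not-all-true true  true  false _ = ≤-refl

module _ {A : Set} where

  count-∷ : ∀ (f : A → Bool) o L → count f (o ∷ L) ≡ bit (f o) + count f L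
  count-∷ f o L with f o
  ... | true  = refl
  ... | false = refl

  count-none : ∀ (f : A → Bool) L → (∀ o → f o ≡ false) → count f L ≡ 0
  count-none f []      _     = refl
  count-none f (o ∷ L) never
    rewrite count-∷ f o L | never o = count-none f L never

  count-complement : ∀ (f g : A → Bool) L → (∀ o → f o ≡ not (g o)) →
                     count f L + count g L ≡ length L
  count-complement f g []      _    = refl
  count-complement f g (o ∷ L) f≡¬g
    rewrite count-∷ f o L | count-∷ g o L | f≡¬g o = begin
      bit (not (g o)) + count f L + (bit (g o) + count g L)
        ≡⟨ interchange (bit (not (g o))) (count f L) (bit (g o)) (count g L) ⟩
      (bit (not (g o)) + bit (g o)) + (count f L + count g L)
        ≡⟨ cong₂ _+_ (bit-complement (g o)) (count-complement f g L f≡¬g) ⟩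
      suc (length L) ∎
    where
    open ≡-Reasoning
    interchange : ∀ a b c d → a + b + (c + d) ≡ a + c + (b + d)
    interchange = solve-∀

  count-triple : ∀ (f g h : A → Bool) L → (∀ o → f o ∧ g o ∧ h o ≡ false) →
                 count f L + count g L + count h L ℕ.≤ 2 * length L
  count-triple f g h []      _     = z≤n
  count-triple f g h (o ∷ L) never
    rewrite count-∷ f o L | count-∷ g o L | count-∷ h o L = begin
      bit (f o) + count f L + (bit (g o) + count g L) + (bit (h o) + count h L)
        ≡⟨ interchange (bit (f o)) (count f L) (bit (g o)) (count g L) (bit (h o)) (count h L) ⟩
      (bit (f o) + bit (g o) + bit (h o)) + (count f L + count g L + count h L)
        ≤⟨ +-mono-≤ (bits-not-all-true (f o) (g o) (h o) (never o)) (count-triple f g h L never) ⟩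
      2 + 2 * length L
        ≡⟨ *-suc 2 (length L) ⟨
      2 * suc (length L) ∎
    where
    open ≤-Reasoning
    interchange : ∀ a b c d e f → a + b + (c + d) + (e + f) ≡ a + c + e + (b + d + f)
    interchange = solve-∀

module _ {n : ℕ} where

  ∈ᵇ-complete : ∀ {y : Fin n} {l} → y ∈ l → (y ∈ᵇ l) ≡ true
  ∈ᵇ-complete {y} {z ∷ l} y∈ with z ≟ y | y∈
  ... | yes _  | _          = refl
  ... | no z≢y | here y≡z   = ⊥-elim (z≢y (sym y≡z))
  ... | no _   | there y∈l  = ∈ᵇ-complete y∈l

  ∈ᵇ-sound : ∀ {y : Fin n} {l} → All (y ≢_) l → (y ∈ᵇ l) ≡ false
  ∈ᵇ-sound {y} {[]}    []             = refl
  ∈ᵇ-sound {y} {z ∷ l} (y≢z ∷ y∉l) with z ≟ y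
  ... | yes z≡y = ⊥-elim (y≢z (sym z≡y))
  ... | no _    = ∈ᵇ-sound y∉l

  ∈-tail : ∀ {y z : Fin n} {l} → y ∈ z ∷ l → z ≢ y → y ∈ l
  ∈-tail (here y≡z)  z≢y = ⊥-elim (z≢y (sym y≡z))
  ∈-tail (there y∈l) _   = y∈l

  earlier-irrefl : ∀ {l : List (Fin n)} x → Unique l → earlier l x x ≡ false
  earlier-irrefl {[]}    x _             = refl
  earlier-irrefl {z ∷ l} x (z∉l ∷ uniq) with z ≟ x
  ... | yes refl = ∈ᵇ-sound z∉l
  ... | no _     = earlier-irrefl x uniq

  earlier-complement : ∀ {l : List (Fin n)} x y → x ≢ y → x ∈ l → y ∈ l →
                       earlier l x y ≡ not (earlier l y x)
  earlier-complement {z ∷ l} x y x≢y x∈ y∈ with z ≟ x | z ≟ y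
  ... | yes refl | yes refl = ⊥-elim (x≢y refl)
  ... | yes refl | no z≢y   = ∈ᵇ-complete (∈-tail y∈ z≢y)
  ... | no z≢x   | yes refl = sym (cong not (∈ᵇ-complete (∈-tail x∈ z≢x)))
  ... | no z≢x   | no z≢y   = earlier-complement x y x≢y (∈-tail x∈ z≢x) (∈-tail y∈ z≢y)

  earlier-acyclic : ∀ (l : List (Fin n)) x y z → x ≢ y → y ≢ z → x ≢ z →
                    earlier l x y ∧ earlier l y z ∧ earlier l z x ≡ false
  earlier-acyclic []      x y z _   _   _   = refl
  earlier-acyclic (w ∷ l) x y z x≢y y≢z x≢z with w ≟ x | w ≟ y | w ≟ z
  ... | yes refl | yes refl | _        = ⊥-elim (x≢y refl)
  ... | yes refl | _        | yes refl = ⊥-elim (x≢z refl)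
  ... | _        | yes refl | yes refl = ⊥-elim (y≢z refl)
  ... | yes refl | no _     | no _     =
        trans (cong ((y ∈ᵇ l) ∧_) (∧-zeroʳ (earlier l y z))) (∧-zeroʳ (y ∈ᵇ l))
  ... | no _     | yes refl | no _     = refl
  ... | no _     | no _     | yes refl = ∧-zeroʳ (earlier l x y)
  ... | no _     | no _     | no _     = earlier-acyclic l x y z x≢y y≢z x≢z

occurs : ∀ {n} (x : Fin n) (o : TotalOrdering n) → x ∈ proj₁ o
occurs x (l , l↭all) = ∈-resp-↭ (↭-sym l↭all) (∈-allFin x)

duplicate-free : ∀ {n} (o : TotalOrdering n) → Unique (proj₁ o)
duplicate-free {n} (l , l↭all) = Unique-resp-↭ (setoid (Fin n)) (↭⇒↭ₛ (↭-sym l↭all)) (allFin⁺ n)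

-- Counting over a set of orderings Ω: #earlier x y is the numerator of
-- Pr[x<y], and N = |Ω| its denominator.
module Counts {n} (Ω : SetOfOrderings n) where

  N : ℕ
  N = length (orderings Ω)

  private instance
    N≢0 : NonZero N
    N≢0 = nonempty Ω

  #earlier : Fin n → Fin n → ℕ
  #earlier x y = count (λ o → earlier (proj₁ o) x y) (orderings Ω)

  #earlier-self : ∀ x → #earlier x x ≡ 0
  #earlier-self x = count-none _ (orderings Ω) (λ o → earlier-irrefl x (duplicate-free o))

  #earlier-complement : ∀ x y → x ≢ y → #earlier x y + #earlier y x ≡ N
  #earlier-complement x y x≢y = count-complement _ _ (orderings Ω)
    (λ o → earlier-complement x y x≢y (occurs x o) (occurs y o))

  #earlier-cycle : ∀ x y z → x ≢ y → y ≢ z → x ≢ z →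
                   #earlier x y + #earlier y z + #earlier z x ℕ.≤ 2 * N
  #earlier-cycle x y z x≢y y≢z x≢z = count-triple _ _ _ (orderings Ω)
    (λ o → earlier-acyclic (proj₁ o) x y z x≢y y≢z x≢z)

  ≺⇒beyond-⅔ : ∀ {x y} → x ≺[ Ω ] y → BeyondTwoThirds N (#earlier x y)
  ≺⇒beyond-⅔ {x} {y} = fraction-<⇒ 2 (#earlier x y) 3 N

  beyond-⅔⇒≺ : ∀ {x y} → BeyondTwoThirds N (#earlier x y) → x ≺[ Ω ] y
  beyond-⅔⇒≺ {x} {y} = fraction-<⇐ 2 (#earlier x y) 3 N

  below-⅓ : (∀ x y → BalancedPair Ω x y → ⊥) →
            ∀ x y → x ≢ y → ¬ x ≺[ Ω ] y → #earlier x y * 3 ℕ.< N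
  below-⅓ unbalanced x y x≢y x⊀y = ≰⇒> λ N≤3a → unbalanced x y
    ( x≢y
    , fraction-≤⇐ 1 (#earlier x y) 3 N (subst (ℕ._≤ #earlier x y * 3) (sym (*-identityˡ N)) N≤3a)
    , fraction-≤⇐ (#earlier x y) 2 N 3 (≮⇒≥ (λ 2N<3a → x⊀y (beyond-⅔⇒≺ 2N<3a))) )

module _ {n} (Ω : SetOfOrderings n) where
  open Counts Ω

  ≺-irrefl : ∀ {x y : Fin n} → x ≡ y → ¬ x ≺[ Ω ] y
  ≺-irrefl {x} refl x≺x =
    n≮0 (subst (BeyondTwoThirds N) (#earlier-self x) (≺⇒beyond-⅔ x≺x))

  ≺-asym : ∀ {x y : Fin n} → x ≺[ Ω ] y → ¬ y ≺[ Ω ] x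
  ≺-asym {x} {y} x≺y y≺x = beyond-⅔-asym N (#earlier x y) (#earlier y x)
    (#earlier-complement x y (λ x≡y → ≺-irrefl x≡y x≺y)) (≺⇒beyond-⅔ x≺y) (≺⇒beyond-⅔ y≺x)

  ≺-no-3-cycle : ∀ {x y z : Fin n} → x ≺[ Ω ] y → y ≺[ Ω ] z → ¬ z ≺[ Ω ] x
  ≺-no-3-cycle {x} {y} {z} x≺y y≺z z≺x = beyond-⅔-triple N
    (#earlier x y) (#earlier y z) (#earlier z x)
    (#earlier-cycle x y z (λ e → ≺-irrefl e x≺y) (λ e → ≺-irrefl e y≺z) (λ e → ≺-irrefl (sym e) z≺x))
    (≺⇒beyond-⅔ x≺y) (≺⇒beyond-⅔ y≺z) (≺⇒beyond-⅔ z≺x)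

  module _ (unbalanced : ∀ x y → BalancedPair Ω x y → ⊥) where

    -- Distinct x, y are comparable: either #earlier x y exceeds two thirds
    -- of N, or it is below a third and then #earlier y x exceeds two thirds.
    compare-distinct : ∀ x y → x ≢ y → Dec (BeyondTwoThirds N (#earlier x y)) →
                       Tri (x ≺[ Ω ] y) (x ≡ y) (y ≺[ Ω ] x)
    compare-distinct x y x≢y (yes x>⅔) = tri< x≺y x≢y (≺-asym x≺y)
      where
      x≺y : x ≺[ Ω ] y
      x≺y = beyond-⅔⇒≺ x>⅔
    compare-distinct x y x≢y (no x≯⅔) = tri> x⊀y x≢y y≺x
      where
      x⊀y : ¬ x ≺[ Ω ] y
      x⊀y x≺y = x≯⅔ (≺⇒beyond-⅔ x≺y)
      y≺x : y ≺[ Ω ] x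
      y≺x = beyond-⅔⇒≺ (beyond-⅔-complement N (#earlier x y) (#earlier y x)
              (#earlier-complement x y x≢y) (below-⅓ unbalanced x y x≢y x⊀y))

    ≺-compare : Trichotomous _≡_ (λ x y → x ≺[ Ω ] y)
    ≺-compare x y = by-equality (x ≟ y)
      where
      by-equality : Dec (x ≡ y) → Tri (x ≺[ Ω ] y) (x ≡ y) (y ≺[ Ω ] x)
      by-equality (yes x≡y) = tri≈ (≺-irrefl x≡y) x≡y (≺-irrefl (sym x≡y))
      by-equality (no x≢y)  = compare-distinct x y x≢y (2 * N ℕ.<? #earlier x y * 3)

    -- Compare x with z: x = z contradicts asymmetry, z ≺ x closes a 3-cycle.
    ≺-trans : ∀ {x y z} → x ≺[ Ω ] y → y ≺[ Ω ] z → x ≺[ Ω ] z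
    ≺-trans {x} {y} {z} x≺y y≺z = from-trichotomy (≺-compare x z)
      where
      from-trichotomy : Tri (x ≺[ Ω ] z) (x ≡ z) (z ≺[ Ω ] x) → x ≺[ Ω ] z
      from-trichotomy (tri< x≺z _   _)   = x≺z
      from-trichotomy (tri≈ _   x≡z _)   = ⊥-elim (≺-asym x≺y (subst (λ w → y ≺[ Ω ] w) (sym x≡z) y≺z))
      from-trichotomy (tri> _   _   z≺x) = ⊥-elim (≺-no-3-cycle x≺y y≺z z≺x)

lemma1 : ∀ {n} (Ω : SetOfOrderings n) →
    (∀ (x y : Fin n) → BalancedPair Ω x y → ⊥) →
    IsStrictTotalOrder {A = Fin n} _≡_ (λ x y → x ≺[ Ω ] y)
lemma1 Ω unbalanced = record
  { isStrictPartialOrder = record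
    { isEquivalence = isEquivalence
    ; irrefl        = ≺-irrefl Ω
    ; trans         = ≺-trans Ω unbalanced
    ; <-resp-≈      = (λ { refl x≺y → x≺y }) , (λ { refl x≺y → x≺y })
    }
  ; compare = ≺-compare Ω unbalanced
  }
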